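{- Let $c,k$ be positive integers, $n=(2k+1)c$, and $G=Ci(n,\{c,2c,\dots,kc\})$. Then $G$ is closed distance magic if and only if $c$ is odd.
   Context: For $S\subseteq\{1,\dots,\lfloor n/2\rfloor\}$, the circulant graph $Ci(n,S)$ has vertex set $\{v_0,\dots,v_{n-1}\}$, with $v_i$ adjacent to $v_j$ iff $|i-j|\in S$. A graph on $n$ vertices is closed distance magic if there is a bijection $\ell\colon V\to\{1,\dots,n\}$ and a positive integer $k'$ such that the sum of $\ell$ over the closed neighborhood $N[x]$ of every vertex $x$ equals $k'$. -}

module Defs where

open import Data.Bool using (Bool; true; false; if_then_else_; _∨_)
open import Data.Nat using (ℕ; zero; suc; _+_; _*_; _∸_; _<_; _⊔_; _⊓_; ∣_-_∣; _≡ᵇ_)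
open import Data.Fin using (Fin; toℕ)
open import Data.List using (List; map; allFin; applyUpTo)
open import Data.Bool.ListAction using (any)
open import Data.Nat.ListAction using (sum)
open import Data.Product using (Σ; _×_)
open import Relation.Binary.PropositionalEquality using (_≡_)
open import Function.Definitions using (Bijective)

circDist : (n : ℕ) → Fin n → Fin n → ℕ
circDist n i j = ∣ toℕ i - toℕ j ∣ ⊓ (n ∸ ∣ toℕ i - toℕ j ∣)

_∈ᵇ_ : ℕ → List ℕ → Bool
d ∈ᵇ S = any (d ≡ᵇ_) S

CiAdj : (n : ℕ) → List ℕ → Fin n → Fin n → Bool
CiAdj n S i j = circDist n i j ∈ᵇ S

inClosedNbhd : (n : ℕ) → (Fin n → Fin n → Bool) → Fin n → Fin n → Bool
inClosedNbhd n adj x y = (toℕ x ≡ᵇ toℕ y) ∨ adj x y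

-- sum of the labels over N[x]; a label ℓ v : Fin n stands for 1 + toℕ (ℓ v) ∈ {1,…,n}
closedNbhdSum : (n : ℕ) → (Fin n → Fin n → Bool) → (Fin n → Fin n) → Fin n → ℕ
closedNbhdSum n adj ℓ x =
  sum (map (λ y → if inClosedNbhd n adj x y then suc (toℕ (ℓ y)) else 0) (allFin n))

IsClosedDistanceMagic : (n : ℕ) → (Fin n → Fin n → Bool) → Set
IsClosedDistanceMagic n adj =
  Σ (Fin n → Fin n) λ ℓ → Bijective _≡_ _≡_ ℓ ×
    Σ ℕ λ k′ → 0 < k′ × ((x : Fin n) → closedNbhdSum n adj ℓ x ≡ k′)

multiplesUpTo : ℕ → ℕ → List ℕ
multiplesUpTo c k = applyUpTo (λ m → suc m * c) k

-- The closed neighbourhoods of Ci((2k+1)c, {c, 2c, …, kc}) are exactly the residue classes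
-- modulo c, each of size 2k+1, so a closed distance magic labelling is a partition of
-- {1, …, n} into c classes of equal sum k′.  Then c k′ = n(n+1)/2, i.e. 2k′ = (2k+1)(n+1),
-- which is odd when c is even.  Conversely, for c = 2h+1 write the vertex jc + r as the cell
-- (j, r) of a (2k+1) × c array and give it the label jc + σⱼ(r) + 1, where every row σⱼ
-- permutes {0, …, c−1} and all column sums of (σⱼ(r)) agree: three rows r, r + h, −2r − 1
-- (mod c) have column sums 3h, and the remaining 2k − 2 rows alternate 2h − r and r.
module Submission where

open import Defs
open import Data.Bool using (Bool; true; false; if_then_else_; T)
open import Data.Bool.Properties using (T-∨)
open import Data.Empty using (⊥-elim)
open import Data.Nat
open import Data.Nat.Properties
open import Data.Nat.DivMod
open import Data.Nat.Divisibility using (_∣_; divides; ∣m+n∣m⇒∣n; m∣m*n; ∣n⇒∣m*n; ∣1⇒≡1; m%n≡0⇒n∣m)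
open import Data.Nat.Tactic.RingSolver using (solve-∀)
open import Data.Fin as Fin
  using (Fin; zero; suc; toℕ; fromℕ<; fromℕ; inject₁; _↑ˡ_; _↑ʳ_; combine; remQuot; remainder; punchOut)
open import Data.Fin.Properties
  using (toℕ<n; toℕ-fromℕ<; toℕ-fromℕ; toℕ-inject₁; toℕ-injective; toℕ-combine; combine-injective;
         combine-remQuot; remQuot-combine; any?; punchOut-injective; <⇒notInjective)
  renaming (_≟_ to _≟ᶠ_)
open import Data.List using (map; tabulate)
import Data.Nat.ListAction as List
open import Data.List.Relation.Unary.Any.Properties using (any⁺; any⁻; applyUpTo⁺; applyUpTo⁻)
open import Data.Product using (∃-syntax; _×_; _,_; proj₂; uncurry)
open import Data.Sum using (inj₁; inj₂)
open import Function using (_∘_)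
open import Function.Bundles using (_⇔_; mk⇔; mk⤖; Equivalence)
open import Function.Definitions using (Injective; Surjective; Bijective)
open import Function.Properties.Bijection using (⤖⇒↔)
open import Function.Properties.Equivalence using () renaming (trans to ⇔-trans)
open import Relation.Nullary using (¬_; yes; no)
open import Relation.Binary.PropositionalEquality
open import Algebra.Properties.CommutativeMonoid.Sum +-0-commutativeMonoid
  using (sum-syntax; sum-cong-≗; sum-init-last; sum-replicate-zero; ∑-comm; ∑-distrib-+; ∑-permute)

sum-map-tabulate : ∀ {A : Set} {n} (f : A → ℕ) (g : Fin n → A) →
                   List.sum (map f (tabulate g)) ≡ ∑[ i < n ] f (g i)
sum-map-tabulate {n = zero}  f g = refl
sum-map-tabulate {n = suc n} f g = cong (f (g zero) +_) (sum-map-tabulate f (g ∘ suc))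

∑-const : ∀ n x → ∑[ i < n ] x ≡ n * x
∑-const zero    x = refl
∑-const (suc n) x = cong (x +_) (∑-const n x)

∑-suc-pos : ∀ {n} (f : Fin n → ℕ) → 0 < n → 0 < ∑[ i < n ] suc (f i)
∑-suc-pos {suc n} f _ = z<s

∑-↑ : ∀ m {n} (f : Fin (m + n) → ℕ) →
      ∑[ i < m + n ] f i ≡ ∑[ i < m ] f (i ↑ˡ n) + ∑[ i < n ] f (m ↑ʳ i)
∑-↑ zero    f = refl
∑-↑ (suc m) f = trans (cong (f zero +_) (∑-↑ m (f ∘ suc))) (sym (+-assoc (f zero) _ _))

∑-combine : ∀ m {c} (f : Fin (m * c) → ℕ) →
            ∑[ y < m * c ] f y ≡ ∑[ j < m ] ∑[ r < c ] f (combine j r)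
∑-combine zero        f = refl
∑-combine (suc m) {c} f =
  trans (∑-↑ c f) (cong (∑[ r < c ] f (r ↑ˡ m * c) +_) (∑-combine m (f ∘ (c ↑ʳ_))))

∑-select : ∀ {n} (j : Fin n) (f : Fin n → ℕ) →
           ∑[ i < n ] (if toℕ j ≡ᵇ toℕ i then f i else 0) ≡ f j
∑-select {suc n} zero    f = trans (cong (f zero +_) (sum-replicate-zero n)) (+-identityʳ (f zero))
∑-select         (suc j) f = ∑-select j (f ∘ suc)

double-∑-suc-toℕ : ∀ n → 2 * ∑[ i < n ] suc (toℕ i) ≡ n * suc n
double-∑-suc-toℕ zero    = refl
double-∑-suc-toℕ (suc n) = begin
  2 * ∑[ i < suc n ] suc (toℕ i)
    ≡⟨ cong (2 *_) (sum-init-last {n} (suc ∘ toℕ)) ⟩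
  2 * (∑[ i < n ] suc (toℕ (inject₁ i)) + suc (toℕ (fromℕ n)))
    ≡⟨ cong₂ (λ s t → 2 * (s + suc t)) (sum-cong-≗ {n} (cong suc ∘ toℕ-inject₁)) (toℕ-fromℕ n) ⟩
  2 * (S + suc n)
    ≡⟨ *-distribˡ-+ 2 S (suc n) ⟩
  2 * S + 2 * suc n
    ≡⟨ cong (_+ 2 * suc n) (double-∑-suc-toℕ n) ⟩
  n * suc n + 2 * suc n
    ≡⟨ regroup n ⟩
  suc n * suc (suc n) ∎
  where
  open ≡-Reasoning
  S : ℕ
  S = ∑[ i < n ] suc (toℕ i)
  regroup : ∀ n → n * suc n + 2 * suc n ≡ suc n * suc (suc n)
  regroup = solve-∀

∑-period₂ : ∀ m (g : ℕ → ℕ) → (∀ j → g (2 + j) ≡ g j) →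
            ∑[ j < m * 2 ] g (toℕ j) ≡ m * (g 0 + g 1)
∑-period₂ zero    g periodic = refl
∑-period₂ (suc m) g periodic = begin
  ∑[ j < suc m * 2 ] g (toℕ j)               ≡⟨⟩
  g 0 + (g 1 + ∑[ j < m * 2 ] g (2 + toℕ j)) ≡⟨ cong (λ s → g 0 + (g 1 + s)) (sum-cong-≗ {m * 2} (periodic ∘ toℕ)) ⟩
  g 0 + (g 1 + ∑[ j < m * 2 ] g (toℕ j))     ≡⟨ +-assoc (g 0) (g 1) _ ⟨
  g 0 + g 1 + ∑[ j < m * 2 ] g (toℕ j)       ≡⟨ cong (g 0 + g 1 +_) (∑-period₂ m g periodic) ⟩
  g 0 + g 1 + m * (g 0 + g 1)                ∎
  where open ≡-Reasoning

toℕ-combine-% : ∀ {m} c .{{_ : NonZero c}} (j : Fin m) (r : Fin c) → toℕ (combine j r) % c ≡ toℕ r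
toℕ-combine-% c j r = begin
  toℕ (combine j r) % c     ≡⟨ cong (_% c) (trans (toℕ-combine j r) (+-comm (c * toℕ j) (toℕ r))) ⟩
  (toℕ r + c * toℕ j) % c   ≡⟨ cong (λ x → (toℕ r + x) % c) (*-comm c (toℕ j)) ⟩
  (toℕ r + toℕ j * c) % c   ≡⟨ [m+kn]%n≡m%n (toℕ r) (toℕ j) c ⟩
  toℕ r % c                 ≡⟨ m<n⇒m%n≡m (toℕ<n r) ⟩
  toℕ r                     ∎
  where open ≡-Reasoning

toℕ-remainder : ∀ {m} c .{{_ : NonZero c}} (x : Fin (m * c)) → toℕ (remainder {m} c x) ≡ toℕ x % c
toℕ-remainder {m} c x =
  trans (sym (toℕ-combine-% c (Fin.quotient {m} c x) (remainder {m} c x)))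
        (cong (λ y → toℕ y % c) (combine-remQuot {m} c x))

remainder-combine : ∀ {m} c (j : Fin m) (r : Fin c) → remainder {m} c (combine j r) ≡ r
remainder-combine c j r = cong proj₂ (remQuot-combine j r)

injective⇒surjective : ∀ {n} {f : Fin n → Fin n} → Injective _≡_ _≡_ f → Surjective _≡_ _≡_ f
injective⇒surjective {suc n} {f} f-injective y with any? (λ x → f x ≟ᶠ y)
... | yes (x , fx≡y) = x , λ { refl → fx≡y }
... | no ∄x = ⊥-elim (<⇒notInjective (n<1+n n) punchOut∘f-injective)
  where
  fx≢y : ∀ x → y ≢ f x
  fx≢y x y≡fx = ∄x (x , sym y≡fx)
  punchOut∘f-injective : Injective _≡_ _≡_ (λ x → punchOut (fx≢y x))
  punchOut∘f-injective eq = f-injective (punchOut-injective (fx≢y _) (fx≢y _) eq)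

restrict : ∀ {c} (f : ℕ → ℕ) → (∀ {r} → r < c → f r < c) → Fin c → Fin c
restrict f f-< r = fromℕ< (f-< (toℕ<n r))

toℕ-restrict : ∀ {c} (f : ℕ → ℕ) (f-< : ∀ {r} → r < c → f r < c) r → toℕ (restrict f f-< r) ≡ f (toℕ r)
toℕ-restrict f f-< r = toℕ-fromℕ< (f-< (toℕ<n r))

restrict-injective : ∀ {c} (f : ℕ → ℕ) (f-< : ∀ {r} → r < c → f r < c) →
                     (∀ {r r′} → r < c → r′ < c → f r ≡ f r′ → r ≡ r′) →
                     Injective _≡_ _≡_ (restrict f f-<)
restrict-injective f f-< f-injective {r} {r′} eq = toℕ-injective (f-injective (toℕ<n r) (toℕ<n r′)
  (trans (sym (toℕ-restrict f f-< r)) (trans (cong toℕ eq) (toℕ-restrict f f-< r′))))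

2∤2n+1 : ∀ n → ¬ 2 ∣ 2 * n + 1
2∤2n+1 n 2∣2n+1 with ∣1⇒≡1 (∣m+n∣m⇒∣n 2∣2n+1 (m∣m*n n))
... | ()

2m≢2n+1 : ∀ m n → 2 * m ≢ 2 * n + 1
2m≢2n+1 m n eq = 2∤2n+1 n (divides m (trans (sym eq) (*-comm 2 m)))

m+m≤2n+1⇒m≤n : ∀ {m n} → m + m ≤ 2 * n + 1 → m ≤ n
m+m≤2n+1⇒m≤n {m} {n} m+m≤ = ≮⇒≥ λ n<m → n≮n (2 * n + 1) (begin-strict
  2 * n + 1     <⟨ ≤-reflexive (double n) ⟩
  suc n + suc n ≤⟨ +-mono-≤ n<m n<m ⟩
  m + m         ≤⟨ m+m≤ ⟩
  2 * n + 1     ∎)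
  where
  open ≤-Reasoning
  double : ∀ n → suc (2 * n + 1) ≡ suc n + suc n
  double = solve-∀

∣∸⇔%≡ : ∀ c .{{_ : NonZero c}} {a b} → a ≤ b → c ∣ b ∸ a ⇔ b % c ≡ a % c
∣∸⇔%≡ c {a} {b} a≤b = mk⇔ to from
  where
  open ≡-Reasoning
  to : c ∣ b ∸ a → b % c ≡ a % c
  to (divides q b∸a≡qc) = begin
    b % c             ≡⟨ cong (_% c) (m+[n∸m]≡n a≤b) ⟨
    (a + (b ∸ a)) % c ≡⟨ cong (λ x → (a + x) % c) b∸a≡qc ⟩
    (a + q * c) % c   ≡⟨ [m+kn]%n≡m%n a q c ⟩
    a % c             ∎
  from : b % c ≡ a % c → c ∣ b ∸ a
  from b%c≡a%c = divides (b / c ∸ a / c) (begin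
    b ∸ a                                     ≡⟨ cong₂ _∸_ (m≡m%n+[m/n]*n b c) (m≡m%n+[m/n]*n a c) ⟩
    (b % c + b / c * c) ∸ (a % c + a / c * c) ≡⟨ cong (λ x → (x + b / c * c) ∸ (a % c + a / c * c)) b%c≡a%c ⟩
    (a % c + b / c * c) ∸ (a % c + a / c * c) ≡⟨ [m+n]∸[m+o]≡n∸o (a % c) _ _ ⟩
    b / c * c ∸ a / c * c                     ≡⟨ *-distribʳ-∸ c (b / c) (a / c) ⟨
    (b / c ∸ a / c) * c                       ∎)

∣∣-∣⇔%≡ : ∀ c .{{_ : NonZero c}} a b → c ∣ ∣ a - b ∣ ⇔ a % c ≡ b % c
∣∣-∣⇔%≡ c a b with ≤-total a b
... | inj₁ a≤b rewrite m≤n⇒∣m-n∣≡n∸m a≤b = ⇔-trans (∣∸⇔%≡ c a≤b) (mk⇔ sym sym)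
... | inj₂ b≤a rewrite m≤n⇒∣n-m∣≡n∸m b≤a = ∣∸⇔%≡ c b≤a

-- On a cycle of length (2k+1)c the circular distance of the multiple qc is (q ⊓ (2k+1 ∸ q))c.
circDist-multiple : ∀ c k {d} .{{_ : NonZero c}} → 0 < d → d < (2 * k + 1) * c →
  (∃[ m ] m < k × d ⊓ ((2 * k + 1) * c ∸ d) ≡ suc m * c) ⇔ c ∣ d
circDist-multiple c k {d} 0<d d<n = mk⇔ to from
  where
  A : ℕ
  A = 2 * k + 1
  n : ℕ
  n = A * c

  to : (∃[ m ] m < k × d ⊓ (n ∸ d) ≡ suc m * c) → c ∣ d
  to (m , _ , dist≡) with ⊓-sel d (n ∸ d)
  ... | inj₁ dist≡d   = divides (suc m) (trans (sym dist≡d) dist≡)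
  ... | inj₂ dist≡n∸d = ∣m+n∣m⇒∣n (subst (c ∣_) (sym (m∸n+n≡m (<⇒≤ d<n))) (divides A refl))
                                    (divides (suc m) (trans (sym dist≡n∸d) dist≡))

  from : c ∣ d → ∃[ m ] m < k × d ⊓ (n ∸ d) ≡ suc m * c
  from (divides q refl) = witness (q ⊓ (A ∸ q)) (⊓-glb 0<q (m<n⇒0<n∸m q<A)) s≤k dist≡
    where
    q<A : q < A
    q<A = *-cancelʳ-< c q A d<n
    0<q : 0 < q
    0<q = *-cancelʳ-< c 0 q 0<d
    s≤k : q ⊓ (A ∸ q) ≤ k
    s≤k = m+m≤2n+1⇒m≤n (≤-trans (+-mono-≤ (m⊓n≤m q (A ∸ q)) (m⊓n≤n q (A ∸ q)))
                                 (≤-reflexive (m+[n∸m]≡n (<⇒≤ q<A))))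
    dist≡ : q * c ⊓ (n ∸ q * c) ≡ (q ⊓ (A ∸ q)) * c
    dist≡ = trans (cong (q * c ⊓_) (sym (*-distribʳ-∸ c A q))) (sym (*-distribʳ-⊓ c q (A ∸ q)))
    witness : ∀ s → 0 < s → s ≤ k → q * c ⊓ (n ∸ q * c) ≡ s * c →
              ∃[ m ] m < k × q * c ⊓ (n ∸ q * c) ≡ suc m * c
    witness (suc m) _ s≤k eq = m , s≤k , eq

T⇔T⇒≡ : ∀ {p q : Bool} → T p ⇔ T q → p ≡ q
T⇔T⇒≡ {false} {false} _   = refl
T⇔T⇒≡ {false} {true}  p⇔q = ⊥-elim (Equivalence.from p⇔q _)
T⇔T⇒≡ {true}  {false} p⇔q = ⊥-elim (Equivalence.to p⇔q _)
T⇔T⇒≡ {true}  {true}  _   = refl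

≡⇔T≡ᵇ : ∀ {m n} → m ≡ n ⇔ T (m ≡ᵇ n)
≡⇔T≡ᵇ {m} {n} = mk⇔ (≡⇒≡ᵇ m n) (≡ᵇ⇒≡ m n)

∈ᵇ-multiplesUpTo : ∀ {d} c k → T (d ∈ᵇ multiplesUpTo c k) ⇔ (∃[ m ] m < k × d ≡ suc m * c)
∈ᵇ-multiplesUpTo {d} c k = mk⇔
  (λ d∈ → let m , m<k , d≡ = applyUpTo⁻ _ (any⁻ (d ≡ᵇ_) _ d∈) in m , m<k , ≡ᵇ⇒≡ d _ d≡)
  (λ (m , m<k , d≡) → any⁺ (d ≡ᵇ_) (applyUpTo⁺ _ (≡⇒≡ᵇ d _ d≡) m<k))

record BalancedArray (a c : ℕ) : Set where
  field
    row           : Fin a → Fin c → Fin c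
    row-injective : ∀ j → Injective _≡_ _≡_ (row j)
    columnSum     : ℕ
    column-sum    : ∀ r → ∑[ j < a ] toℕ (row j r) ≡ columnSum

module ArrayLabelling {a c} (B : BalancedArray a c) where
  open BalancedArray B

  labelling : Fin (a * c) → Fin (a * c)
  labelling = uncurry (λ j r → combine j (row j r)) ∘ remQuot c

  labelling-combine : ∀ j r → labelling (combine j r) ≡ combine j (row j r)
  labelling-combine j r = cong (uncurry (λ j r → combine j (row j r))) (remQuot-combine j r)

  labelling-injective : Injective _≡_ _≡_ labelling
  labelling-injective {y} {y′} eq =
    trans (sym (combine-remQuot {a} c y))
          (trans (cong (uncurry combine) (cells-equal _ _ _ _ eq)) (combine-remQuot {a} c y′))
    where
    cells-equal : ∀ j r j′ r′ → combine j (row j r) ≡ combine j′ (row j′ r′) → (j , r) ≡ (j′ , r′)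
    cells-equal j r j′ r′ eq with combine-injective j (row j r) j′ (row j′ r′) eq
    ... | refl , row-eq = cong (j ,_) (row-injective j row-eq)

  labelling-bijective : Bijective _≡_ _≡_ labelling
  labelling-bijective = labelling-injective , injective⇒surjective labelling-injective

module Circulant (c k : ℕ) .{{_ : NonZero c}} where

  A : ℕ
  A = 2 * k + 1

  n : ℕ
  n = A * c

  G : Fin n → Fin n → Bool
  G = CiAdj n (multiplesUpTo c k)

  0<A : 0 < A
  0<A = m≤n+m 1 (2 * k)

  closedNbhd⇔sameResidue : ∀ x y → T (inClosedNbhd n G x y) ⇔ toℕ x % c ≡ toℕ y % c
  closedNbhd⇔sameResidue x y with toℕ x ≟ toℕ y
  ... | yes x≡y = mk⇔ (λ _ → cong (_% c) x≡y) (λ _ → Equivalence.from T-∨ (inj₁ (≡⇒≡ᵇ _ _ x≡y)))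
  ... | no  x≢y =
    ⇔-trans (mk⇔ adjacent (Equivalence.from T-∨ ∘ inj₂))
      (⇔-trans (∈ᵇ-multiplesUpTo c k)
        (⇔-trans (circDist-multiple c k 0<d d<n) (∣∣-∣⇔%≡ c (toℕ x) (toℕ y))))
    where
    d : ℕ
    d = ∣ toℕ x - toℕ y ∣
    0<d : 0 < d
    0<d = n≢0⇒n>0 (x≢y ∘ ∣m-n∣≡0⇒m≡n)
    d<n : d < n
    d<n = ≤-<-trans (∣m-n∣≤m⊔n (toℕ x) (toℕ y)) (⊔-lub (toℕ<n x) (toℕ<n y))
    adjacent : T (inClosedNbhd n G x y) → T (G x y)
    adjacent x~y with Equivalence.to T-∨ x~y
    ... | inj₁ x≡ᵇy = ⊥-elim (x≢y (≡ᵇ⇒≡ _ _ x≡ᵇy))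
    ... | inj₂ Gxy  = Gxy

  closedNbhd≡sameResidue : ∀ x y → inClosedNbhd n G x y ≡ (toℕ x % c ≡ᵇ toℕ y % c)
  closedNbhd≡sameResidue x y = T⇔T⇒≡ (⇔-trans (closedNbhd⇔sameResidue x y) ≡⇔T≡ᵇ)

  closedNbhdSum≡column : ∀ ℓ x →
    closedNbhdSum n G ℓ x ≡ ∑[ j < A ] suc (toℕ (ℓ (combine j (remainder {A} c x))))
  closedNbhdSum≡column ℓ x = begin
    closedNbhdSum n G ℓ x
      ≡⟨ sum-map-tabulate (λ y → if inClosedNbhd n G x y then w y else 0) (λ y → y) ⟩
    ∑[ y < n ] (if inClosedNbhd n G x y then w y else 0)
      ≡⟨ ∑-combine A (λ y → if inClosedNbhd n G x y then w y else 0) ⟩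
    ∑[ j < A ] ∑[ r < c ] (if inClosedNbhd n G x (combine j r) then w (combine j r) else 0)
      ≡⟨ sum-cong-≗ {A} (λ j → sum-cong-≗ {c} (λ r → cong (if_then w (combine j r) else 0) (sameColumn j r))) ⟩
    ∑[ j < A ] ∑[ r < c ] (if toℕ X ≡ᵇ toℕ r then w (combine j r) else 0)
      ≡⟨ sum-cong-≗ {A} (λ j → ∑-select X (w ∘ combine j)) ⟩
    ∑[ j < A ] w (combine j X) ∎
    where
    open ≡-Reasoning
    X : Fin c
    X = remainder {A} c x
    w : Fin n → ℕ
    w y = suc (toℕ (ℓ y))
    sameColumn : ∀ j r → inClosedNbhd n G x (combine j r) ≡ (toℕ X ≡ᵇ toℕ r)
    sameColumn j r = trans (closedNbhd≡sameResidue x (combine j r))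
                           (cong₂ _≡ᵇ_ (sym (toℕ-remainder {A} c x)) (toℕ-combine-% c j r))

  c*k′≡∑labels : ∀ {ℓ} → Bijective _≡_ _≡_ ℓ → ∀ {k′} → (∀ x → closedNbhdSum n G ℓ x ≡ k′) →
                  c * k′ ≡ ∑[ y < n ] suc (toℕ y)
  c*k′≡∑labels {ℓ} ℓ-bijective {k′} magic = begin
    c * k′                                 ≡⟨ ∑-const c k′ ⟨
    ∑[ X < c ] k′                          ≡⟨ sum-cong-≗ {c} column ⟩
    ∑[ X < c ] ∑[ j < A ] w (combine j X)  ≡⟨ ∑-comm {c} {A} (λ X j → w (combine j X)) ⟩
    ∑[ j < A ] ∑[ X < c ] w (combine j X)  ≡⟨ ∑-combine A w ⟨
    ∑[ y < n ] suc (toℕ (ℓ y))             ≡⟨ ∑-permute {n} {n} (suc ∘ toℕ) (⤖⇒↔ (mk⤖ ℓ-bijective)) ⟨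
    ∑[ y < n ] suc (toℕ y)                 ∎
    where
    open ≡-Reasoning
    w : Fin n → ℕ
    w y = suc (toℕ (ℓ y))
    j₀ : Fin A
    j₀ = fromℕ< 0<A
    column : ∀ X → k′ ≡ ∑[ j < A ] w (combine j X)
    column X = begin
      k′
        ≡⟨ magic (combine j₀ X) ⟨
      closedNbhdSum n G ℓ (combine j₀ X)
        ≡⟨ closedNbhdSum≡column ℓ (combine j₀ X) ⟩
      ∑[ j < A ] w (combine j (remainder {A} c (combine j₀ X)))
        ≡⟨ cong (λ X → ∑[ j < A ] w (combine j X)) (remainder-combine c j₀ X) ⟩
      ∑[ j < A ] w (combine j X) ∎

  magic⇒odd : IsClosedDistanceMagic n G → ¬ 2 ∣ c
  magic⇒odd (ℓ , ℓ-bijective , k′ , _ , magic) 2∣c = 2∤2n+1 k 2∣A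
    where
    2k′≡A[n+1] : 2 * k′ ≡ A * suc n
    2k′≡A[n+1] = *-cancelˡ-≡ (2 * k′) (A * suc n) c (begin
      c * (2 * k′)             ≡⟨ x*[2*y]≡2*[x*y] c k′ ⟩
      2 * (c * k′)             ≡⟨ cong (2 *_) (c*k′≡∑labels ℓ-bijective magic) ⟩
      2 * ∑[ y < n ] suc (toℕ y) ≡⟨ double-∑-suc-toℕ n ⟩
      (A * c) * suc n          ≡⟨ [x*y]*z≡y*[x*z] A c (suc n) ⟩
      c * (A * suc n)          ∎)
      where
      open ≡-Reasoning
      x*[2*y]≡2*[x*y] : ∀ x y → x * (2 * y) ≡ 2 * (x * y)
      x*[2*y]≡2*[x*y] = solve-∀
      [x*y]*z≡y*[x*z] : ∀ x y z → (x * y) * z ≡ y * (x * z)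
      [x*y]*z≡y*[x*z] = solve-∀
    2∣A[n+1] : 2 ∣ A * n + A
    2∣A[n+1] = divides k′ (begin
      A * n + A  ≡⟨ +-comm (A * n) A ⟩
      A + A * n  ≡⟨ *-suc A n ⟨
      A * suc n  ≡⟨ 2k′≡A[n+1] ⟨
      2 * k′     ≡⟨ *-comm 2 k′ ⟩
      k′ * 2     ∎)
      where open ≡-Reasoning
    2∣A : 2 ∣ A
    2∣A = ∣m+n∣m⇒∣n 2∣A[n+1] (∣n⇒∣m*n A (∣n⇒∣m*n A 2∣c))

  balanced⇒magic : BalancedArray A c → IsClosedDistanceMagic n G
  balanced⇒magic B = labelling , labelling-bijective , K , 0<K , magic
    where
    open BalancedArray B
    open ArrayLabelling B
    K : ℕ
    K = ∑[ j < A ] suc (c * toℕ j) + columnSum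
    0<K : 0 < K
    0<K = ≤-trans (∑-suc-pos (λ j → c * toℕ j) 0<A) (m≤m+n _ columnSum)
    magic : ∀ x → closedNbhdSum n G labelling x ≡ K
    magic x = begin
      closedNbhdSum n G labelling x
        ≡⟨ closedNbhdSum≡column labelling x ⟩
      ∑[ j < A ] suc (toℕ (labelling (combine j X)))
        ≡⟨ sum-cong-≗ {A} (λ j → cong (suc ∘ toℕ) (labelling-combine j X)) ⟩
      ∑[ j < A ] suc (toℕ (combine j (row j X)))
        ≡⟨ sum-cong-≗ {A} (λ j → cong suc (toℕ-combine j (row j X))) ⟩
      ∑[ j < A ] (suc (c * toℕ j) + toℕ (row j X))
        ≡⟨ ∑-distrib-+ (λ j → suc (c * toℕ j)) (λ j → toℕ (row j X)) ⟩
      ∑[ j < A ] suc (c * toℕ j) + ∑[ j < A ] toℕ (row j X)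
        ≡⟨ cong (∑[ j < A ] suc (c * toℕ j) +_) (column-sum X) ⟩
      K ∎
      where
      open ≡-Reasoning
      X : Fin c
      X = remainder {A} c x

-- On 0 ≤ r ≤ 2h these are r ↦ r + h and r ↦ −2r − 1 modulo 2h + 1.
shift : ℕ → ℕ → ℕ
shift h r with r ≤? h
... | yes _ = r + h
... | no  _ = r ∸ suc h

twist : ℕ → ℕ → ℕ
twist h r with r ≤? h
... | yes _ = 2 * (h ∸ r)
... | no  _ = 2 * (2 * h ∸ r) + 1

2*n∸n≡n : ∀ n → 2 * n ∸ n ≡ n
2*n∸n≡n n = trans (m+n∸m≡n n (n + 0)) (+-identityʳ n)

upper-shift-< : ∀ {h r} → h < r → r ≤ 2 * h → r ∸ suc h < h
upper-shift-< {h} {r} h<r r≤2h = +-cancelˡ-≤ h _ _ (begin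
  h + suc (r ∸ suc h) ≡⟨ +-suc h _ ⟩
  suc h + (r ∸ suc h) ≡⟨ m+[n∸m]≡n h<r ⟩
  r                   ≤⟨ r≤2h ⟩
  2 * h               ≡⟨ cong (h +_) (+-identityʳ h) ⟩
  h + h               ∎)
  where open ≤-Reasoning

upper-twist-< : ∀ {h r} → h < r → r ≤ 2 * h → 2 * h ∸ r < h
upper-twist-< {h} {r} h<r r≤2h = subst (2 * h ∸ r <_) (2*n∸n≡n h) (∸-monoʳ-< h<r r≤2h)

shift-≤ : ∀ h {r} → r ≤ 2 * h → shift h r ≤ 2 * h
shift-≤ h {r} r≤2h with r ≤? h
... | yes r≤h = ≤-trans (+-monoˡ-≤ h r≤h) (≤-reflexive (cong (h +_) (sym (+-identityʳ h))))
... | no  _   = ≤-trans (m∸n≤m r (suc h)) r≤2h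

twist-≤ : ∀ h {r} → r ≤ 2 * h → twist h r ≤ 2 * h
twist-≤ h {r} r≤2h with r ≤? h
... | yes _   = *-monoʳ-≤ 2 (m∸n≤m h r)
... | no  r≰h = begin
  2 * s + 1 ≤⟨ +-monoʳ-≤ (2 * s) (n≤1+n 1) ⟩
  2 * s + 2 ≡⟨ +-comm (2 * s) 2 ⟩
  2 + 2 * s ≡⟨ *-suc 2 s ⟨
  2 * suc s ≤⟨ *-monoʳ-≤ 2 (upper-twist-< (≰⇒> r≰h) r≤2h) ⟩
  2 * h     ∎
  where
  open ≤-Reasoning
  s : ℕ
  s = 2 * h ∸ r

shift-injective : ∀ h {r r′} → r ≤ 2 * h → r′ ≤ 2 * h → shift h r ≡ shift h r′ → r ≡ r′
shift-injective h {r} {r′} r≤2h r′≤2h eq with r ≤? h | r′ ≤? h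
... | yes _ | yes _ = +-cancelʳ-≡ h r r′ eq
... | no r≰h | no r′≰h = ∸-cancelʳ-≡ (≰⇒> r≰h) (≰⇒> r′≰h) eq
... | yes _ | no r′≰h = ⊥-elim (<⇒≱ (upper-shift-< (≰⇒> r′≰h) r′≤2h) (≤-trans (m≤n+m h r) (≤-reflexive eq)))
... | no r≰h | yes _ = ⊥-elim (<⇒≱ (upper-shift-< (≰⇒> r≰h) r≤2h) (≤-trans (m≤n+m h r′) (≤-reflexive (sym eq))))

twist-injective : ∀ h {r r′} → r ≤ 2 * h → r′ ≤ 2 * h → twist h r ≡ twist h r′ → r ≡ r′
twist-injective h {r} {r′} r≤2h r′≤2h eq with r ≤? h | r′ ≤? h
... | yes r≤h | yes r′≤h = ∸-cancelˡ-≡ r≤h r′≤h (*-cancelˡ-≡ (h ∸ r) (h ∸ r′) 2 eq)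
... | no _ | no _ = ∸-cancelˡ-≡ r≤2h r′≤2h (*-cancelˡ-≡ (2 * h ∸ r) (2 * h ∸ r′) 2 (+-cancelʳ-≡ 1 _ _ eq))
... | yes _ | no _ = ⊥-elim (2m≢2n+1 (h ∸ r) (2 * h ∸ r′) eq)
... | no _ | yes _ = ⊥-elim (2m≢2n+1 (h ∸ r′) (2 * h ∸ r) (sym eq))

r+shift+twist≡3h : ∀ h {r} → r ≤ 2 * h → r + (shift h r + twist h r) ≡ 3 * h
r+shift+twist≡3h h {r} r≤2h with r ≤? h
... | yes r≤h = subst (λ x → r + ((r + x) + 2 * t) ≡ 3 * x) (m+[n∸m]≡n r≤h) (lower r t)
  where
  t : ℕ
  t = h ∸ r
  lower : ∀ r t → r + ((r + (r + t)) + 2 * t) ≡ 3 * (r + t)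
  lower = solve-∀
... | no r≰h = subst (λ x → x + (u + (2 * v + 1)) ≡ 3 * h) e₁ (upper h u v (trans (cong (_+ v) e₁) e₂))
  where
  u : ℕ
  u = r ∸ suc h
  v : ℕ
  v = 2 * h ∸ r
  e₁ : suc h + u ≡ r
  e₁ = m+[n∸m]≡n (≰⇒> r≰h)
  e₂ : r + v ≡ 2 * h
  e₂ = m+[n∸m]≡n r≤2h
  rearrange : ∀ h u v → h + suc (u + v) ≡ suc h + u + v
  rearrange = solve-∀
  upper-sum : ∀ u v → suc (suc (u + v)) + u + (u + (2 * v + 1)) ≡ 3 * suc (u + v)
  upper-sum = solve-∀
  -- 2h = r + v forces h = 1 + u + v, after which the identity is polynomial.
  upper : ∀ h u v → suc h + u + v ≡ 2 * h → suc h + u + (u + (2 * v + 1)) ≡ 3 * h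
  upper h u v e
    with +-cancelˡ-≡ h (suc (u + v)) h (trans (rearrange h u v) (trans e (cong (h +_) (+-identityʳ h))))
  ... | refl = upper-sum u v

row : ℕ → ℕ → ℕ → ℕ
row h 0 r = r
row h 1 r = shift h r
row h 2 r = twist h r
row h 3 r = 2 * h ∸ r
row h 4 r = r
row h (suc (suc (suc (suc (suc j))))) r = row h (suc (suc (suc j))) r

row-≤ : ∀ h j {r} → r ≤ 2 * h → row h j r ≤ 2 * h
row-≤ h 0 r≤2h = r≤2h
row-≤ h 1 r≤2h = shift-≤ h r≤2h
row-≤ h 2 r≤2h = twist-≤ h r≤2h
row-≤ h 3 {r} _ = m∸n≤m (2 * h) r
row-≤ h 4 r≤2h = r≤2h
row-≤ h (suc (suc (suc (suc (suc j))))) r≤2h = row-≤ h (suc (suc (suc j))) r≤2h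

row-injective : ∀ h j {r r′} → r ≤ 2 * h → r′ ≤ 2 * h → row h j r ≡ row h j r′ → r ≡ r′
row-injective h 0 _ _ eq = eq
row-injective h 1 r≤2h r′≤2h eq = shift-injective h r≤2h r′≤2h eq
row-injective h 2 r≤2h r′≤2h eq = twist-injective h r≤2h r′≤2h eq
row-injective h 3 r≤2h r′≤2h eq = ∸-cancelˡ-≡ r≤2h r′≤2h eq
row-injective h 4 _ _ eq = eq
row-injective h (suc (suc (suc (suc (suc j))))) r≤2h r′≤2h eq =
  row-injective h (suc (suc (suc j))) r≤2h r′≤2h eq

row-column-sum : ∀ h m {r} → r ≤ 2 * h → ∑[ j < 3 + m * 2 ] row h (toℕ j) r ≡ 3 * h + m * (2 * h)
row-column-sum h m {r} r≤2h = begin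
  ∑[ j < 3 + m * 2 ] row h (toℕ j) r
    ≡⟨⟩
  r + (shift h r + (twist h r + ∑[ j < m * 2 ] row h (3 + toℕ j) r))
    ≡⟨ reassociate r (shift h r) (twist h r) _ ⟩
  r + (shift h r + twist h r) + ∑[ j < m * 2 ] row h (3 + toℕ j) r
    ≡⟨ cong₂ _+_ (r+shift+twist≡3h h r≤2h) (∑-period₂ m (λ j → row h (3 + j) r) (λ _ → refl)) ⟩
  3 * h + m * ((2 * h ∸ r) + r)
    ≡⟨ cong (λ x → 3 * h + m * x) (m∸n+n≡m r≤2h) ⟩
  3 * h + m * (2 * h) ∎
  where
  open ≡-Reasoning
  reassociate : ∀ a b d s → a + (b + (d + s)) ≡ a + (b + d) + s
  reassociate = solve-∀

oddArray : ∀ h m → BalancedArray (2 * suc m + 1) (suc (2 * h))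
oddArray h m = record
  { row           = σ
  ; row-injective = σ-injective
  ; columnSum     = 3 * h + m * (2 * h)
  ; column-sum    = σ-column-sum
  }
  where
  open ≡-Reasoning
  A : ℕ
  A = 2 * suc m + 1
  row-< : ∀ j {r} → r < suc (2 * h) → row h j r < suc (2 * h)
  row-< j = s≤s ∘ row-≤ h j ∘ s≤s⁻¹
  σ : Fin A → Fin (suc (2 * h)) → Fin (suc (2 * h))
  σ j = restrict (row h (toℕ j)) (row-< (toℕ j))
  σ-injective : ∀ j → Injective _≡_ _≡_ (σ j)
  σ-injective j = restrict-injective (row h (toℕ j)) (row-< (toℕ j))
    (λ r<c r′<c → row-injective h (toℕ j) (s≤s⁻¹ r<c) (s≤s⁻¹ r′<c))
  A≡3+m*2 : ∀ m → 2 * suc m + 1 ≡ 3 + m * 2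
  A≡3+m*2 = solve-∀
  σ-column-sum : ∀ r → ∑[ j < A ] toℕ (σ j r) ≡ 3 * h + m * (2 * h)
  σ-column-sum r = begin
    ∑[ j < A ] toℕ (σ j r)                   ≡⟨ sum-cong-≗ {A} (λ j → toℕ-restrict (row h (toℕ j)) (row-< (toℕ j)) r) ⟩
    ∑[ j < A ] row h (toℕ j) (toℕ r)         ≡⟨ cong (λ a → ∑[ j < a ] row h (toℕ j) (toℕ r)) (A≡3+m*2 m) ⟩
    ∑[ j < 3 + m * 2 ] row h (toℕ j) (toℕ r) ≡⟨ row-column-sum h m (s≤s⁻¹ (toℕ<n r)) ⟩
    3 * h + m * (2 * h)                      ∎

odd⇒2h+1 : ∀ c → ¬ 2 ∣ c → c ≡ suc (2 * (c / 2))
odd⇒2h+1 c 2∤c with c % 2 in c%2≡ | m%n<n c 2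
... | 0           | _ = ⊥-elim (2∤c (m%n≡0⇒n∣m c 2 c%2≡))
... | 1           | _ =
  trans (m≡m%n+[m/n]*n c 2) (trans (cong (_+ (c / 2) * 2) c%2≡) (cong suc (*-comm (c / 2) 2)))
... | suc (suc _) | s≤s (s≤s ())

mainTheorem16 : (c k : ℕ) → 0 < c → 0 < k →
    IsClosedDistanceMagic ((2 * k + 1) * c) (CiAdj ((2 * k + 1) * c) (multiplesUpTo c k))
      ⇔ (¬ (2 ∣ c))
mainTheorem16 c (suc m) 0<c _ = mk⇔ magic⇒odd odd⇒magic
  where
  instance
    c≢0 : NonZero c
    c≢0 = >-nonZero 0<c
  open Circulant c (suc m)
  odd⇒magic : ¬ 2 ∣ c → IsClosedDistanceMagic n G
  odd⇒magic 2∤c = balanced⇒magic (subst (BalancedArray A) (sym (odd⇒2h+1 c 2∤c)) (oddArray (c / 2) m))
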